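{- Let $H=(V,E)$ be a $k$-uniform hypergraph such that $\deg_H(u)\equiv 0 \pmod{k}$ for every vertex $u$ of $H$. Then $H$ has no cut edges.
   Context: A hypergraph $H=(V,E)$ consists of a nonempty finite vertex set $V$, a finite edge set $E$, and an incidence function $\psi:E\to 2^V$; edges are identified with their vertex sets (parallel edges allowed). $H$ is $k$-uniform if $|e|=k$ for all $e\in E$. $\deg_H(u)$ is the number of edges containing $u$. Two distinct vertices are adjacent via $e$ if both lie in $e$; a walk is a sequence $v_0e_1v_1\dots e_kv_k$ with $v_{i-1},v_i$ adjacent via $e_i$. For an equivalence class $V'$ of "joined by a walk", the connected component is $(V',\{f\in E:\emptyset\ne f\subseteq V'\})$; $\omega(H)$ is the number of components. $H-e=(V,E\setminus\{e\})$, and $e$ is a cut edge if $\omega(H-e)>\omega(H)$. -}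

module Defs where

open import Data.Nat using (ℕ; suc; _<_)
open import Data.Nat.Divisibility using (_∣_)
open import Data.Fin using (Fin)
open import Data.Fin.Subset using (Subset; _∈_; ∣_∣)
open import Data.Fin.Subset.Properties using (_∈?_)
open import Data.List using (List; length; filter; removeAt)
open import Data.List.Membership.Propositional renaming (_∈_ to _∈ₗ_)
open import Data.Product using (Σ; ∃; _×_)
open import Relation.Binary.PropositionalEquality using (_≡_; _≢_)
open import Relation.Binary.Construct.Closure.ReflexiveTransitive using (Star)
open import Function.Bundles using (_⇔_)

-- A hypergraph on the nonempty vertex set Fin (suc n'), i.e. n = suc n' ≥ 1
-- vertices.  Edges form a list (parallel edges allowed), each edge identified
-- with its vertex set (a Subset).
record Hypergraph : Set where
  field
    n′    : ℕ
    edges : List (Subset (suc n′))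

open Hypergraph public

Vtx : Hypergraph → Set
Vtx H = Fin (suc (n′ H))

Edge : Hypergraph → Set
Edge H = Fin (length (edges H))

Uniform : ℕ → Hypergraph → Set
Uniform k H = ∀ {f} → f ∈ₗ edges H → ∣ f ∣ ≡ k

deg : (H : Hypergraph) → Vtx H → ℕ
deg H u = length (filter (u ∈?_) (edges H))

Adjacent : (H : Hypergraph) → Vtx H → Vtx H → Set
Adjacent H u v = u ≢ v × ∃ λ f → f ∈ₗ edges H × u ∈ f × v ∈ f

Connected : (H : Hypergraph) → Vtx H → Vtx H → Set
Connected H = Star (Adjacent H)

-- ω(H) = c : there are exactly c connected components, i.e. a surjective
-- labelling of vertices by Fin c whose fibres are exactly the classes of
-- "joined by a walk".
NumComponents : Hypergraph → ℕ → Set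
NumComponents H c =
  Σ (Vtx H → Fin c) λ lab →
    (∀ u v → (lab u ≡ lab v) ⇔ Connected H u v) ×
    (∀ (i : Fin c) → ∃ λ u → lab u ≡ i)

_-ₑ_ : (H : Hypergraph) → Edge H → Hypergraph
H -ₑ e = record { n′ = n′ H ; edges = removeAt (edges H) e }

IsCutEdge : (H : Hypergraph) → Edge H → Set
IsCutEdge H e = ∃ λ c → ∃ λ c′ → NumComponents H c × NumComponents (H -ₑ e) c′ × c < c′

-- Let C be the component of H − e containing a vertex x of e. Summing degrees over C counts
-- each edge f with multiplicity ∣ f ∩ C ∣, so k divides Σ_f ∣ f ∩ C ∣. Every edge of H − e
-- lies inside C or misses it, contributing 0 or k, hence k ∣ ∣ e ∩ C ∣. As 0 < ∣ e ∩ C ∣ ≤ k,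
-- this forces e ⊆ C: the vertices of e stay joined in H − e, so deleting e leaves every
-- component intact.
module Submission where

open import Defs
open import Level using (Level)
open import Data.Bool using (true; false)
open import Data.Nat using (ℕ; zero; suc; _+_; _<_; z≤n; NonZero; >-nonZero)
open import Data.Nat.Properties using (+-comm; +-commutativeSemigroup; <⇒≱; ≤-<-trans)
open import Data.Nat.ListAction using (sum)
open import Data.Nat.Divisibility using (_∣_; _∣0; ∣⇒≤; ∣-reflexive; ∣m∣n⇒∣m+n; ∣m+n∣m⇒∣n)
open import Algebra.Properties.CommutativeSemigroup +-commutativeSemigroup using (x∙yz≈y∙xz)
open import Data.Fin using (Fin; zero; suc; _≟_)
open import Data.Fin.Properties using (injective⇒≤)
open import Data.Fin.Subset using (Subset; _∈_; _⊆_; ∣_∣; _∩_; inside; outside; Nonempty)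
open import Data.Fin.Subset.Properties
  using (_∈?_; nonempty?; Empty-unique; ∣⊥∣≡0; ⊆-antisym; p∩q⊆p; x∈p∩q⁺; x∈p∩q⁻; p⊂q⇒∣p∣<∣q∣; x∈p⇒∣p-x∣<∣p∣)
open import Data.Vec using ([]; _∷_; tail; tabulate; here; there)
open import Data.Vec.Properties using (lookup∘tabulate; lookup⇒[]=; []=⇒lookup)
open import Data.List using (List; []; _∷_; length; filter; map; lookup; removeAt)
open import Data.List.Membership.Propositional renaming (_∈_ to _∈ₗ_)
open import Data.List.Membership.Propositional.Properties using (∈-lookup)
open import Data.List.Relation.Unary.Any using (here; there)
open import Data.Product using (_,_; proj₁; proj₂)
open import Data.Sum using (_⊎_; inj₁; inj₂)
open import Function using (_∘_; _∘′_)
open import Function.Bundles using (Equivalence)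
open import Relation.Nullary using (¬_; does; proof; yes; no; contradiction)
open import Relation.Nullary.Decidable using (dec-true)
open import Relation.Nullary.Reflects using (Reflects; invert)
open import Relation.Unary using (Pred; Decidable)
open import Relation.Binary.PropositionalEquality using (_≡_; refl; sym; trans; cong; subst)
open import Relation.Binary.Construct.Closure.ReflexiveTransitive using (ε; _◅_; _◅◅_)

private variable
  ℓ : Level
  A : Set
  x : A
  m k : ℕ
  p q : Subset m

sum-map-removeAt : ∀ (g : A → ℕ) xs i → sum (map g xs) ≡ g (lookup xs i) + sum (map g (removeAt xs i))
sum-map-removeAt g (x ∷ xs) zero    = refl
sum-map-removeAt g (x ∷ xs) (suc i) =
  trans (cong (g x +_) (sum-map-removeAt g xs i)) (x∙yz≈y∙xz (g x) (g (lookup xs i)) _)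

∣-sum-map : ∀ (g : A → ℕ) xs → (∀ {x} → x ∈ₗ xs → k ∣ g x) → k ∣ sum (map g xs)
∣-sum-map g []       _   = _ ∣0
∣-sum-map g (x ∷ xs) k∣g = ∣m∣n⇒∣m+n (k∣g (here refl)) (∣-sum-map g xs (k∣g ∘ there))

∣sum-map⇒∣lookup : ∀ (g : A → ℕ) xs i → k ∣ sum (map g xs) →
                   (∀ {x} → x ∈ₗ removeAt xs i → k ∣ g x) → k ∣ g (lookup xs i)
∣sum-map⇒∣lookup {k = k} g xs i k∣Σ k∣rest = ∣m+n∣m⇒∣n k∣Σ′ (∣-sum-map g (removeAt xs i) k∣rest)
  where
  k∣Σ′ : k ∣ sum (map g (removeAt xs i)) + g (lookup xs i)
  k∣Σ′ = subst (k ∣_) (trans (sum-map-removeAt g xs i) (+-comm (g (lookup xs i)) _)) k∣Σ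

∈-removeAt⁻ : ∀ (xs : List A) i → x ∈ₗ removeAt xs i → x ∈ₗ xs
∈-removeAt⁻ (y ∷ xs) zero    x∈         = there x∈
∈-removeAt⁻ (y ∷ xs) (suc i) (here x≡y) = here x≡y
∈-removeAt⁻ (y ∷ xs) (suc i) (there x∈) = there (∈-removeAt⁻ xs i x∈)

∈⇒≡lookup⊎∈-removeAt : ∀ (xs : List A) i → x ∈ₗ xs → x ≡ lookup xs i ⊎ x ∈ₗ removeAt xs i
∈⇒≡lookup⊎∈-removeAt (y ∷ xs) zero    (here x≡y) = inj₁ x≡y
∈⇒≡lookup⊎∈-removeAt (y ∷ xs) zero    (there x∈) = inj₂ x∈
∈⇒≡lookup⊎∈-removeAt (y ∷ xs) (suc i) (here x≡y) = inj₂ (here x≡y)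
∈⇒≡lookup⊎∈-removeAt (y ∷ xs) (suc i) (there x∈) with ∈⇒≡lookup⊎∈-removeAt xs i x∈
... | inj₁ x≡ = inj₁ x≡
... | inj₂ x∈′ = inj₂ (there x∈′)

subset : {P : Pred (Fin m) ℓ} → Decidable P → Subset m
subset P? = tabulate (does ∘ P?)

∈-subset⁺ : {P : Pred (Fin m) ℓ} (P? : Decidable P) {x : Fin m} → P x → x ∈ subset P?
∈-subset⁺ P? {x} px = lookup⇒[]= x _ (trans (lookup∘tabulate (does ∘ P?) x) (dec-true (P? x) px))

∈-subset⁻ : {P : Pred (Fin m) ℓ} (P? : Decidable P) {x : Fin m} → x ∈ subset P? → P x
∈-subset⁻ P? {x} x∈P = invert (subst (Reflects _) does≡true (proof (P? x)))
  where
  does≡true : does (P? x) ≡ true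
  does≡true = trans (sym (lookup∘tabulate (does ∘ P?) x)) ([]=⇒lookup x∈P)

[p∩q≢∅⇒p⊆q]⇒∣p∣∣∣p∩q∣ : (Nonempty (p ∩ q) → p ⊆ q) → ∣ p ∣ ∣ ∣ p ∩ q ∣
[p∩q≢∅⇒p⊆q]⇒∣p∣∣∣p∩q∣ {m} {p} {q} closed with nonempty? (p ∩ q)
... | yes p∩q≢∅ = ∣-reflexive (cong ∣_∣ (⊆-antisym p⊆p∩q (p∩q⊆p p q)))
  where
  p⊆p∩q : p ⊆ p ∩ q
  p⊆p∩q x∈p = x∈p∩q⁺ (x∈p , closed p∩q≢∅ x∈p)
... | no  p∩q≡∅ = subst (∣ p ∣ ∣_) (sym ∣p∩q∣≡0) (∣ p ∣ ∣0)
  where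
  ∣p∩q∣≡0 : ∣ p ∩ q ∣ ≡ 0
  ∣p∩q∣≡0 = trans (cong ∣_∣ (Empty-unique p∩q≡∅)) (∣⊥∣≡0 m)

∣p∣∣∣p∩q∣⇒p⊆q : Nonempty (p ∩ q) → ∣ p ∣ ∣ ∣ p ∩ q ∣ → p ⊆ q
∣p∣∣∣p∩q∣⇒p⊆q {p = p} {q} (x , x∈p∩q) ∣p∣∣∣p∩q∣ {y} y∈p with y ∈? q
... | yes y∈q = y∈q
... | no  y∉q = contradiction (∣⇒≤ ∣p∣∣∣p∩q∣) (<⇒≱ ∣p∩q∣<∣p∣)
  where
  instance
    ∣p∩q∣≢0 : NonZero ∣ p ∩ q ∣
    ∣p∩q∣≢0 = >-nonZero (≤-<-trans z≤n (x∈p⇒∣p-x∣<∣p∣ x∈p∩q))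
  ∣p∩q∣<∣p∣ : ∣ p ∩ q ∣ < ∣ p ∣
  ∣p∩q∣<∣p∣ = p⊂q⇒∣p∣<∣q∣ (p∩q⊆p p q , y , y∈p , y∉q ∘′ proj₂ ∘′ x∈p∩q⁻ p q)

degree : List (Subset m) → Fin m → ℕ
degree L u = length (filter (u ∈?_) L)

incidences : Subset m → List (Subset m) → ℕ
incidences C L = sum (map (λ f → ∣ f ∩ C ∣) L)

degree-map-tail : ∀ (L : List (Subset (suc m))) w → degree (map tail L) w ≡ degree L (suc w)
degree-map-tail []            w = refl
degree-map-tail ((_ ∷ f) ∷ L) w with does (w ∈? f)
... | true  = cong suc (degree-map-tail L w)
... | false = degree-map-tail L w

incidences-[] : ∀ L → incidences [] L ≡ 0
incidences-[] []       = refl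
incidences-[] ([] ∷ L) = incidences-[] L

incidences-outside : ∀ (C : Subset m) L → incidences (outside ∷ C) L ≡ incidences C (map tail L)
incidences-outside C []                  = refl
incidences-outside C ((inside  ∷ f) ∷ L) = cong (∣ f ∩ C ∣ +_) (incidences-outside C L)
incidences-outside C ((outside ∷ f) ∷ L) = cong (∣ f ∩ C ∣ +_) (incidences-outside C L)

incidences-inside : ∀ (C : Subset m) L →
                    incidences (inside ∷ C) L ≡ degree L zero + incidences C (map tail L)
incidences-inside C []                  = refl
incidences-inside C ((inside  ∷ f) ∷ L) =
  cong suc (trans (cong (∣ f ∩ C ∣ +_) (incidences-inside C L)) (x∙yz≈y∙xz ∣ f ∩ C ∣ (degree L zero) _))
incidences-inside C ((outside ∷ f) ∷ L) =
  trans (cong (∣ f ∩ C ∣ +_) (incidences-inside C L)) (x∙yz≈y∙xz ∣ f ∩ C ∣ (degree L zero) _)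

∣degree-tail : ∀ {b} {C : Subset m} L → (∀ {w} → w ∈ b ∷ C → k ∣ degree L w) →
               ∀ {w} → w ∈ C → k ∣ degree (map tail L) w
∣degree-tail L k∣deg {w} w∈C = subst (_ ∣_) (sym (degree-map-tail L w)) (k∣deg (there w∈C))

-- Double counting, by induction on the vertex set: the incidences with C are the degrees in C.
∣-incidences : ∀ (C : Subset m) L → (∀ {w} → w ∈ C → k ∣ degree L w) → k ∣ incidences C L
∣-incidences []            L _     = subst (_ ∣_) (sym (incidences-[] L)) (_ ∣0)
∣-incidences (outside ∷ C) L k∣deg =
  subst (_ ∣_) (sym (incidences-outside C L)) (∣-incidences C (map tail L) (∣degree-tail L k∣deg))
∣-incidences (inside ∷ C)  L k∣deg =
  subst (_ ∣_) (sym (incidences-inside C L))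
    (∣m∣n⇒∣m+n (k∣deg here) (∣-incidences C (map tail L) (∣degree-tail L k∣deg)))

edge⇒Connected : ∀ (G : Hypergraph) {f} → f ∈ₗ edges G → ∀ {u v} → u ∈ f → v ∈ f → Connected G u v
edge⇒Connected G f∈G {u} {v} u∈f v∈f with u ≟ v
... | yes refl = ε
... | no  u≢v  = (u≢v , _ , f∈G , u∈f , v∈f) ◅ ε

JoinedWithout : (H : Hypergraph) → Edge H → Set
JoinedWithout H e = ∀ {u v} → u ∈ lookup (edges H) e → v ∈ lookup (edges H) e → Connected (H -ₑ e) u v

JoinedWithout⇒Connected-removal : ∀ {H e} → JoinedWithout H e →
                                  ∀ {u v} → Connected H u v → Connected (H -ₑ e) u v
JoinedWithout⇒Connected-removal joined ε = ε
JoinedWithout⇒Connected-removal {H} {e} joined ((u≢w , f , f∈H , u∈f , w∈f) ◅ walk)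
  with ∈⇒≡lookup⊎∈-removeAt (edges H) e f∈H
... | inj₁ refl   = joined u∈f w∈f ◅◅ JoinedWithout⇒Connected-removal joined walk
... | inj₂ f∈H-e  = (u≢w , f , f∈H-e , u∈f , w∈f) ◅ JoinedWithout⇒Connected-removal joined walk

-- Send each component of H − e to the component of H containing one of its vertices.
Connected-removal⇒¬IsCutEdge : ∀ {H e} → (∀ {u v} → Connected H u v → Connected (H -ₑ e) u v) →
                               ¬ IsCutEdge H e
Connected-removal⇒¬IsCutEdge {H} preserved
  (c , c′ , (lab , lab≡⇔ , _) , (lab′ , lab′≡⇔ , lab′-onto) , c<c′) =
  <⇒≱ c<c′ (injective⇒≤ lab∘rep-injective)
  where
  rep : Fin c′ → Vtx H
  rep i = proj₁ (lab′-onto i)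
  lab∘rep-injective : ∀ {i j} → lab (rep i) ≡ lab (rep j) → i ≡ j
  lab∘rep-injective {i} {j} eq = trans (sym (proj₂ (lab′-onto i)))
    (trans (Equivalence.from (lab′≡⇔ _ _) (preserved (Equivalence.to (lab≡⇔ _ _) eq)))
           (proj₂ (lab′-onto j)))

divisibleDegrees⇒JoinedWithout : ∀ {k H} → Uniform k H → (∀ u → k ∣ deg H u) →
                                 ∀ e {c′} → NumComponents (H -ₑ e) c′ → JoinedWithout H e
divisibleDegrees⇒JoinedWithout {k} {H} uniform k∣deg e (lab′ , lab′≡⇔ , _) {x} {y} x∈e y∈e =
  Equivalence.to (lab′≡⇔ x y) (sym (∈-subset⁻ sameLabel? (e⊆C y∈e)))
  where
  L : List (Subset (suc (n′ H)))
  L = edges H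

  sameLabel? : Decidable (λ w → lab′ w ≡ lab′ x)
  sameLabel? w = lab′ w ≟ lab′ x

  C : Subset (suc (n′ H))
  C = subset sameLabel?

  closed : ∀ {f} → f ∈ₗ removeAt L e → Nonempty (f ∩ C) → f ⊆ C
  closed {f} f∈ (w , w∈f∩C) {z} z∈f =
    ∈-subset⁺ sameLabel? (trans (sym lab′w≡lab′z) (∈-subset⁻ sameLabel? w∈C))
    where
    w∈f : w ∈ f
    w∈f = proj₁ (x∈p∩q⁻ _ C w∈f∩C)
    w∈C : w ∈ C
    w∈C = proj₂ (x∈p∩q⁻ _ C w∈f∩C)
    lab′w≡lab′z : lab′ w ≡ lab′ z
    lab′w≡lab′z = Equivalence.from (lab′≡⇔ _ _) (edge⇒Connected (H -ₑ e) f∈ w∈f z∈f)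

  k∣e∩C : k ∣ ∣ lookup L e ∩ C ∣
  k∣e∩C = ∣sum-map⇒∣lookup (λ f → ∣ f ∩ C ∣) L e (∣-incidences C L (λ {w} _ → k∣deg w)) k∣f∩C
    where
    k∣f∩C : ∀ {f} → f ∈ₗ removeAt L e → k ∣ ∣ f ∩ C ∣
    k∣f∩C {f} f∈ =
      subst (_∣ ∣ f ∩ C ∣) (uniform (∈-removeAt⁻ L e f∈)) ([p∩q≢∅⇒p⊆q]⇒∣p∣∣∣p∩q∣ (closed f∈))

  e⊆C : lookup L e ⊆ C
  e⊆C = ∣p∣∣∣p∩q∣⇒p⊆q (x , x∈p∩q⁺ (x∈e , ∈-subset⁺ sameLabel? refl))
                     (subst (_∣ ∣ lookup L e ∩ C ∣) (sym (uniform (∈-lookup e))) k∣e∩C)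

theorem3p21 : (k : ℕ) (H : Hypergraph) → Uniform k H →
    (∀ (u : Vtx H) → k ∣ deg H u) →
    ∀ (e : Edge H) → ¬ IsCutEdge H e
theorem3p21 k H uniform k∣deg e cut@(_ , _ , _ , ω[H-e] , _) =
  Connected-removal⇒¬IsCutEdge
    (JoinedWithout⇒Connected-removal (divisibleDegrees⇒JoinedWithout uniform k∣deg e ω[H-e]))
    cut
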